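{- Let $d\ge2$ be an integer and let $(A_{m,n})_{m,n\ge1}$ be the $d$-Ostrowski array. Then it is a $d$-Stolarsky array, i.e.: (1) each row satisfies $A_{m,n+1}=dA_{m,n}+A_{m,n-1}$ for all $n\ge2$; (2) each positive integer occurs exactly once among the entries $A_{m,n}$, $m,n\ge1$; (3) for every sequence $(B_n)$ of positive integers satisfying $B_{n+1}=dB_n+B_{n-1}$, there exists $m$ such that $(A_{m,n})_n$ and $(B_n)$ are tail equivalent.
   Context: Define $(D_n)$ by $D_0=0$, $D_1=1$, $D_{n+1}=dD_n+D_{n-1}$. An Ostrowski word is a finite word $d_1\cdots d_i$ over $\{0,\dots,d\}$ with $0\le d_1<d$, $0\le d_j\le d$ for $j>1$, and $d_{j-1}=0$ whenever $d_j=d$; it represents $\sum_j d_jD_j$. Every non-negative integer has a unique Ostrowski word with nonzero last digit. An Ostrowski word is trimmed if its last digit is nonzero and it cannot be written as $0v$ with $v$ an Ostrowski word (equivalently, its first digit is nonzero, or its first two digits are $0$ and $d$). Let $w_1,w_2,\dots$ be the trimmed Ostrowski words listed in increasing order of the integers they represent. The $d$-Ostrowski array is $A_{m,n}=$ the integer represented by $0^{n-1}w_m$, for $m,n\ge1$. Two sequences $(X_n)$, $(Y_n)$ are tail equivalent if there is an integer $j$ such that $X_n=Y_{n+j}$ for all sufficiently large $n$. -}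

module Defs where

open import Data.Nat using (ℕ; zero; suc; _+_; _*_; _∸_; _≤_; _<_)
open import Data.List using (List; []; _∷_; _++_; [_]; replicate)
open import Data.List.Relation.Unary.All using (All)
open import Data.Product using (Σ; ∃; ∃-syntax; _×_; _,_)
open import Data.Sum using (_⊎_)
open import Data.Unit using (⊤)
open import Relation.Binary.PropositionalEquality using (_≡_; _≢_)
open import Relation.Nullary using (¬_)

D : ℕ → ℕ → ℕ
D d zero = 0
D d (suc zero) = 1
D d (suc (suc n)) = d * D d (suc n) + D d n

-- Words d_1 ⋯ d_i are lists [d_1, …, d_i].
FirstDigitOk : ℕ → List ℕ → Set
FirstDigitOk d [] = ⊤
FirstDigitOk d (x ∷ _) = x < d

AdjOk : ℕ → List ℕ → Set
AdjOk d [] = ⊤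
AdjOk d (x ∷ []) = ⊤
AdjOk d (x ∷ y ∷ r) = (y ≡ d → x ≡ 0) × AdjOk d (y ∷ r)

IsOstrowski : ℕ → List ℕ → Set
IsOstrowski d u = FirstDigitOk d u × All (_≤ d) u × AdjOk d u

valFrom : ℕ → ℕ → List ℕ → ℕ
valFrom d k [] = 0
valFrom d k (x ∷ r) = x * D d k + valFrom d (suc k) r

val : ℕ → List ℕ → ℕ
val d u = valFrom d 1 u

LastNonzero : List ℕ → Set
LastNonzero u = ∃[ v ] ∃[ x ] (u ≡ v ++ [ x ] × x ≢ 0)

IsTrimmed : ℕ → List ℕ → Set
IsTrimmed d u = IsOstrowski d u × LastNonzero u
              × ¬ (∃[ v ] (u ≡ 0 ∷ v × IsOstrowski d v))

IsTrimmedListing : ℕ → (ℕ → List ℕ) → Set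
IsTrimmedListing d w =
  (∀ m → 1 ≤ m → IsTrimmed d (w m))
  × (∀ m m' → 1 ≤ m → m < m' → val d (w m) < val d (w m'))
  × (∀ u → IsTrimmed d u → ∃[ m ] (1 ≤ m × w m ≡ u))

OstrowskiArray : ℕ → (ℕ → List ℕ) → ℕ → ℕ → ℕ
OstrowskiArray d w m n = val d (replicate (n ∸ 1) 0 ++ w m)

-- tail equivalence of sequences indexed by n ≥ 1: ∃ j ∈ ℤ, X_n = Y_{n+j} for all large n
-- (j ≥ 0 and j < 0 written as two cases)
TailEquiv : (ℕ → ℕ) → (ℕ → ℕ) → Set
TailEquiv X Y =
  (∃[ j ] ∃[ N ] (∀ n → N ≤ n → X n ≡ Y (n + j)))
  ⊎ (∃[ j ] ∃[ N ] (∀ n → N ≤ n → X (n + j) ≡ Y n))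

IsStolarsky : ℕ → (ℕ → ℕ → ℕ) → Set
IsStolarsky d A =
  (∀ m n → 1 ≤ m → 2 ≤ n → A m (suc n) ≡ d * A m n + A m (n ∸ 1))
  × (∀ N → 1 ≤ N →
       (∃[ m ] ∃[ n ] (1 ≤ m × 1 ≤ n × A m n ≡ N))
       × (∀ m n m' n' → 1 ≤ m → 1 ≤ n → 1 ≤ m' → 1 ≤ n' →
            A m n ≡ N → A m' n' ≡ N → m ≡ m' × n ≡ n'))
  × (∀ (B : ℕ → ℕ) →
       (∀ n → 1 ≤ n → 1 ≤ B n) →
       (∀ n → 2 ≤ n → B (suc n) ≡ d * B n + B (n ∸ 1)) →
       ∃[ m ] (1 ≤ m × TailEquiv (λ n → A m n) B))

{-# OPTIONS --safe #-}
-- Values of an Ostrowski word satisfy the recurrence of D in every position, so row m of the array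
-- reads w_m from position n on, which gives (1). Greedy division by the D_k and the bound
-- val u < D_(|u|+1) give every N a unique Ostrowski word without trailing zeros; stripping its
-- leading zeros writes it uniquely as 0^k w_m, i.e. N = A_(m,k+1), which gives (2). For (3), let φ be
-- the positive root of t² = d t + 1: for an Ostrowski word u of value x, the value y of 0u is the unique
-- integer with y + d < φ (x + 1) < y + d + 1. A positive solution B of the recurrence
-- keeps |B_(n+1)² − d B_n B_(n+1) − B_n²| constant (Cassini), so once B_n exceeds that constant,
-- consecutive terms satisfy the same inequalities; from then on B is a row of the word representing
-- one of its terms, hence a tail of a row of A.
module Submission where

open import Defs
open import Data.Nat using (ℕ; zero; suc; _+_; _*_; _∸_; _≤_; _<_; z≤n; s≤s; _≟_; _<?_; _≤?_; ∣_-_∣;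
  NonZero; >-nonZero; ≢-nonZero; _≤′_; ≤′-refl; ≤′-step; s≤s⁻¹)
open import Data.Nat.Properties
open import Data.Nat.DivMod using (_/_; _%_; m≡m%n+[m/n]*n; m%n<n; m<n*o⇒m/o<n)
open import Data.Nat.Tactic.RingSolver using (solve-∀)
open import Data.List using (List; []; _∷_; _++_; [_]; replicate; length)
open import Data.List.Properties using (length-++; ∷-injective)
open import Data.List.Relation.Unary.All as All using (All; []; _∷_; all?)
open import Data.List.Relation.Unary.All.Properties using (++⁺; ++⁻ˡ; ++⁻ʳ)
open import Data.List.Reverse using (Reverse; []; _∶_∶ʳ_; reverseView)
open import Data.Product using (Σ; ∃-syntax; _×_; _,_; proj₁; proj₂)
open import Data.Sum using (_⊎_; inj₁; inj₂) renaming ([_,_] to either)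
open import Data.Empty using (⊥-elim)
open import Data.Unit using (⊤; tt)
open import Relation.Binary using (tri<; tri≈; tri>)
open import Relation.Binary.PropositionalEquality hiding ([_])
open import Relation.Nullary using (¬_; Dec; yes; no)
open import Relation.Nullary.Decidable using (_×-dec_; _→-dec_; ¬?)

module Enumeration (P : ℕ → Set) (P? : ∀ n → Dec (P n)) (unbounded : ∀ x → ∃[ y ] (x < y × P y)) where

  private
    least-from : ∀ i k → P (i + k) → ∃[ y ] (i ≤ y × P y × (∀ j → i ≤ j → j < y → ¬ P j))
    least-from i k p with P? i
    ... | yes pᵢ = i , ≤-refl , pᵢ , λ j i≤j j<i → ⊥-elim (<⇒≱ j<i i≤j)
    least-from i zero p | no ¬pᵢ = ⊥-elim (¬pᵢ (subst P (+-identityʳ i) p))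
    least-from i (suc k) p | no ¬pᵢ =
      let y , i<y , p-y , gap = least-from (suc i) k (subst P (+-suc i k) p)
      in y , <⇒≤ i<y , p-y , λ j i≤j j<y →
           either (λ i<j → gap j i<j j<y) (λ i≡j → subst (λ j → ¬ P j) i≡j ¬pᵢ) (m≤n⇒m<n∨m≡n i≤j)

    abstract
      next : ∀ x → ∃[ y ] (x < y × P y × (∀ j → x < j → j < y → ¬ P j))
      next x = let y , x<y , p-y = unbounded x in
        least-from (suc x) (y ∸ suc x) (subst P (sym (m+[n∸m]≡n x<y)) p-y)

  -- enum 0 = 0 only seeds the recursion; the enumeration of P proper is enum 1, enum 2, …
  enum : ℕ → ℕ
  enum zero = 0
  enum (suc m) = proj₁ (next (enum m))

  enum-P : ∀ m → P (enum (suc m))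
  enum-P m = proj₁ (proj₂ (proj₂ (next (enum m))))

  enum-<-suc : ∀ m → enum m < enum (suc m)
  enum-<-suc m = proj₁ (proj₂ (next (enum m)))

  enum-gap : ∀ m j → enum m < j → j < enum (suc m) → ¬ P j
  enum-gap m = proj₂ (proj₂ (proj₂ (next (enum m))))

  enum-mono : ∀ {m m′} → m < m′ → enum m < enum m′
  enum-mono m<m′ = go (≤⇒≤′ m<m′)
    where
      go : ∀ {m m′} → suc m ≤′ m′ → enum m < enum m′
      go {m} ≤′-refl = enum-<-suc m
      go (≤′-step {n} p) = <-trans (go p) (enum-<-suc n)

  n≤enum : ∀ m → m ≤ enum m
  n≤enum zero = z≤n
  n≤enum (suc m) = ≤-<-trans (n≤enum m) (enum-<-suc m)

  enum-surjective : ∀ y → 0 < y → P y → ∃[ m ] (1 ≤ m × enum m ≡ y)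
  enum-surjective y y>0 p-y with reached y
    where
      reached : ∀ m → enum m < y ⊎ ∃[ m′ ] (1 ≤ m′ × enum m′ ≡ y)
      reached zero = inj₁ y>0
      reached (suc m) with reached m
      ... | inj₂ hit = inj₂ hit
      ... | inj₁ below with <-cmp (enum (suc m)) y
      ...   | tri< lt _ _ = inj₁ lt
      ...   | tri≈ _ eq _ = inj₂ (suc m , s≤s z≤n , eq)
      ...   | tri> _ _ gt = ⊥-elim (enum-gap m y below gt p-y)
  ... | inj₂ hit = hit
  ... | inj₁ enum-y<y = ⊥-elim (<⇒≱ enum-y<y (n≤enum y))

+-*-< : ∀ {p a b Y} q → p < Y → a < b → p + a * Y < q + b * Y
+-*-< {p} {a} {b} {Y} q p<Y a<b = begin-strict
  p + a * Y   <⟨ +-monoˡ-< (a * Y) p<Y ⟩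
  suc a * Y   ≤⟨ *-monoˡ-≤ Y a<b ⟩
  b * Y       ≤⟨ m≤n+m (b * Y) q ⟩
  q + b * Y   ∎
  where open ≤-Reasoning

digit-unique : ∀ {p q a b Y} → p < Y → q < Y → p + a * Y ≡ q + b * Y → a ≡ b
digit-unique {a = a} {b} p<Y q<Y eq with <-cmp a b
... | tri< a<b _ _ = ⊥-elim (<-irrefl eq (+-*-< _ p<Y a<b))
... | tri≈ _ a≡b _ = a≡b
... | tri> _ _ b<a = ⊥-elim (<-irrefl (sym eq) (+-*-< _ q<Y b<a))

m∸n+o≡m+[o∸n] : ∀ {m n o} → n ≤ m → n ≤ o → m ∸ n + o ≡ m + (o ∸ n)
m∸n+o≡m+[o∸n] {m} {n} {o} n≤m n≤o = trans (sym (+-∸-comm o n≤m)) (+-∸-assoc m n≤o)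

shifted⇒tailEquiv : ∀ {X Y : ℕ → ℕ} a b → (∀ i → X (i + a) ≡ Y (i + b)) → TailEquiv X Y
shifted⇒tailEquiv {X} {Y} a b shifted with a ≤? b
... | yes a≤b = inj₁ (b ∸ a , a , λ n a≤n →
  trans (cong X (sym (m∸n+n≡m a≤n))) (trans (shifted (n ∸ a)) (cong Y (m∸n+o≡m+[o∸n] a≤n a≤b))))
... | no a≰b = inj₂ (a ∸ b , b , λ n b≤n →
  trans (cong X (sym (m∸n+o≡m+[o∸n] b≤n b≤a))) (trans (shifted (n ∸ b)) (cong Y (m∸n+n≡m b≤n))))
  where
    b≤a : b ≤ a
    b≤a = <⇒≤ (≰⇒> a≰b)

length-∷ʳ : ∀ {A : Set} (xs : List A) a → length (xs ++ [ a ]) ≡ suc (length xs)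
length-∷ʳ xs a = trans (length-++ xs) (+-comm (length xs) 1)

module Values (d : ℕ) where

  valFrom-rec : ∀ k u → valFrom d (2 + k) u ≡ d * valFrom d (1 + k) u + valFrom d k u
  valFrom-rec k [] = sym (trans (+-identityʳ (d * 0)) (*-zeroʳ d))
  valFrom-rec k (a ∷ u) = begin
    a * D d (2 + k) + valFrom d (3 + k) u
      ≡⟨ cong (a * D d (2 + k) +_) (valFrom-rec (suc k) u) ⟩
    a * (d * D d (1 + k) + D d k) + (d * valFrom d (2 + k) u + valFrom d (1 + k) u)
      ≡⟨ regroup d a (D d (1 + k)) (D d k) (valFrom d (2 + k) u) (valFrom d (1 + k) u) ⟩
    d * (a * D d (1 + k) + valFrom d (2 + k) u) + (a * D d k + valFrom d (1 + k) u) ∎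
    where
      open ≡-Reasoning
      regroup : ∀ d a p q v w → a * (d * p + q) + (d * v + w) ≡ d * (a * p + v) + (a * q + w)
      regroup = solve-∀

  valFrom-zeros : ∀ i j t → valFrom d i (replicate j 0 ++ t) ≡ valFrom d (i + j) t
  valFrom-zeros i zero t = cong (λ n → valFrom d n t) (sym (+-identityʳ i))
  valFrom-zeros i (suc j) t =
    trans (valFrom-zeros (suc i) j t) (cong (λ n → valFrom d n t) (sym (+-suc i j)))

  valFrom-∷ʳ : ∀ k xs a → valFrom d k (xs ++ [ a ]) ≡ valFrom d k xs + a * D d (k + length xs)
  valFrom-∷ʳ k [] a = trans (+-identityʳ _) (cong (λ n → a * D d n) (sym (+-identityʳ k)))
  valFrom-∷ʳ k (x ∷ xs) a = begin
    x * D d k + valFrom d (suc k) (xs ++ [ a ])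
      ≡⟨ cong (x * D d k +_) (valFrom-∷ʳ (suc k) xs a) ⟩
    x * D d k + (valFrom d (suc k) xs + a * D d (suc k + length xs))
      ≡⟨ sym (+-assoc (x * D d k) _ _) ⟩
    valFrom d k (x ∷ xs) + a * D d (suc k + length xs)
      ≡⟨ cong (λ n → valFrom d k (x ∷ xs) + a * D d n) (sym (+-suc k (length xs))) ⟩
    valFrom d k (x ∷ xs) + a * D d (k + length (x ∷ xs)) ∎
    where open ≡-Reasoning

  val-∷ʳ : ∀ xs a → val d (xs ++ [ a ]) ≡ val d xs + a * D d (suc (length xs))
  val-∷ʳ = valFrom-∷ʳ 1

  recurrence-unique : ∀ {X Y : ℕ → ℕ} →
    (∀ i → X (2 + i) ≡ d * X (1 + i) + X i) → (∀ i → Y (2 + i) ≡ d * Y (1 + i) + Y i) →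
    X 0 ≡ Y 0 → X 1 ≡ Y 1 → ∀ i → X i ≡ Y i
  recurrence-unique {X} {Y} recX recY eq₀ eq₁ i = proj₁ (agree i)
    where
      agree : ∀ i → X i ≡ Y i × X (1 + i) ≡ Y (1 + i)
      agree zero = eq₀ , eq₁
      agree (suc i) with agree i
      ... | eq , eq′ = eq′ , trans (recX i) (trans (cong₂ (λ a b → d * a + b) eq′ eq) (sym (recY i)))

  listing-injective : ∀ {w m m′} → IsTrimmedListing d w → 1 ≤ m → 1 ≤ m′ → w m ≡ w m′ → m ≡ m′
  listing-injective {m = m} {m′} (_ , increasing , _) m≥1 m′≥1 eq with <-cmp m m′
  ... | tri< lt _ _ = ⊥-elim (<-irrefl (cong (val d) eq) (increasing m m′ m≥1 lt))
  ... | tri≈ _ m≡m′ _ = m≡m′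
  ... | tri> _ _ gt = ⊥-elim (<-irrefl (cong (val d) (sym eq)) (increasing m′ m m′≥1 gt))

  ostrowskiArray-row : ∀ w m n → OstrowskiArray d w m (suc n) ≡ valFrom d (suc n) (w m)
  ostrowskiArray-row w m n = valFrom-zeros 1 n (w m)

  ostrowskiArray-rec : ∀ w m n → 2 ≤ n →
    OstrowskiArray d w m (suc n) ≡ d * OstrowskiArray d w m n + OstrowskiArray d w m (n ∸ 1)
  ostrowskiArray-rec w m (suc (suc n)) (s≤s (s≤s z≤n)) = begin
    OstrowskiArray d w m (3 + n)   ≡⟨ ostrowskiArray-row w m (2 + n) ⟩
    valFrom d (3 + n) (w m)         ≡⟨ valFrom-rec (suc n) (w m) ⟩
    d * valFrom d (2 + n) (w m) + valFrom d (1 + n) (w m)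
      ≡⟨ sym (cong₂ (λ a b → d * a + b) (ostrowskiArray-row w m (suc n)) (ostrowskiArray-row w m n)) ⟩
    d * OstrowskiArray d w m (2 + n) + OstrowskiArray d w m (1 + n) ∎
    where open ≡-Reasoning

module Golden (d : ℕ) where
  open Values d

  -- With φ the positive root of t² = d t + 1, Above X Y says Y > φ X and Below X Y says Y < φ X.
  Above Below : ℕ → ℕ → Set
  Above X Y = d * X * Y + X * X < Y * Y
  Below X Y = Y * Y < d * X * Y + X * X

  private
    -- both sides of a comparison at (X, Y) plus d X Y + (d Y)² give the comparison at (Y, X + d Y)
    square-next : ∀ d X Y → (d * X * Y + X * X) + (d * X * Y + d * Y * (d * Y)) ≡ (X + d * Y) * (X + d * Y)
    square-next = solve-∀
    cross-next : ∀ d X Y → Y * Y + (d * X * Y + d * Y * (d * Y)) ≡ d * Y * (X + d * Y) + Y * Y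
    cross-next = solve-∀

  above⇒below : ∀ {X Y} → Above X Y → Below Y (X + d * Y)
  above⇒below {X} {Y} h =
    subst₂ _<_ (square-next d X Y) (cross-next d X Y) (+-monoˡ-< (d * X * Y + d * Y * (d * Y)) h)

  below⇒above : ∀ {X Y} → Below X Y → Above Y (X + d * Y)
  below⇒above {X} {Y} h =
    subst₂ _<_ (cross-next d X Y) (square-next d X Y) (+-monoˡ-< (d * X * Y + d * Y * (d * Y)) h)

  <⇒below : ∀ {X Y} → Y < d * X → Below X Y
  <⇒below {zero} {Y} lt = ⊥-elim (n≮0 (subst (Y <_) (*-zeroʳ d) lt))
  <⇒below {suc X} {Y} lt = begin-strict
    Y * Y                           ≤⟨ *-monoˡ-≤ Y (<⇒≤ lt) ⟩
    d * suc X * Y                   <⟨ m<m+n (d * suc X * Y) (s≤s z≤n) ⟩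
    d * suc X * Y + suc X * suc X   ∎
    where open ≤-Reasoning

  above⇒≤ : ∀ {X Y} → Above X Y → d * X ≤ Y
  above⇒≤ {X} {Y} h = ≮⇒≥ (λ lt → <-asym (<⇒below {X} {Y} lt) h)

  above⇒¬below : ∀ {X Y} → Above X Y → ¬ Below X Y
  above⇒¬below {X} {Y} = <-asym {d * X * Y + X * X} {Y * Y}

  private
    -- for d X ≤ Y, raising Y by k raises Y² by at least as much as d X Y + X²
    expand-cross : ∀ d X Y k → d * X * (Y + k) + X * X ≡ (d * X * Y + X * X) + d * X * k
    expand-cross = solve-∀
    expand-square : ∀ Y k → (Y + k) * (Y + k) ≡ Y * Y + (Y * k + (Y * k + k * k))
    expand-square = solve-∀
    cross-increment≤ : ∀ {X Y} k → d * X ≤ Y → d * X * k ≤ Y * k + (Y * k + k * k)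
    cross-increment≤ {X} {Y} k le = ≤-trans (*-monoˡ-≤ k le) (m≤m+n (Y * k) _)

  above-+ : ∀ {X Y} k → Above X Y → Above X (Y + k)
  above-+ {X} {Y} k h = subst₂ _<_ (sym (expand-cross d X Y k)) (sym (expand-square Y k))
    (+-mono-<-≤ h (cross-increment≤ k (above⇒≤ h)))

  above-mono : ∀ {X Y Y′} → Above X Y → Y ≤ Y′ → Above X Y′
  above-mono {Y = Y} h le = subst (Above _) (m+[n∸m]≡n le) (above-+ (_ ∸ Y) h)

  below-+ : ∀ {X Y} k → Below X (Y + k) → Below X Y
  below-+ {X} {Y} k h with Y * Y <? d * X * Y + X * X
  ... | yes below = below
  ... | no ¬below = ⊥-elim (≤⇒≯ not-below h)
    where
      not-below₀ : d * X * Y + X * X ≤ Y * Y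
      not-below₀ = ≮⇒≥ ¬below
      not-below : d * X * (Y + k) + X * X ≤ (Y + k) * (Y + k)
      not-below = subst₂ _≤_ (sym (expand-cross d X Y k)) (sym (expand-square Y k))
        (+-mono-≤ not-below₀ (cross-increment≤ k (≮⇒≥ (λ lt → ¬below (<⇒below lt)))))

  below-antimono : ∀ {X Y Y′} → Below X Y′ → Y ≤ Y′ → Below X Y
  below-antimono {Y = Y} h le = below-+ (_ ∸ Y) (subst (Below _) (sym (m+[n∸m]≡n le)) h)

  floor-unique : ∀ {X Y₁ Y₂} → Below X Y₁ → Above X (suc Y₁) → Below X Y₂ → Above X (suc Y₂) → Y₁ ≡ Y₂
  floor-unique {Y₁ = Y₁} {Y₂} b₁ a₁ b₂ a₂ with <-cmp Y₁ Y₂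
  ... | tri< lt _ _ = ⊥-elim (above⇒¬below (above-mono a₁ lt) b₂)
  ... | tri≈ _ eq _ = eq
  ... | tri> _ _ gt = ⊥-elim (above⇒¬below (above-mono a₂ gt) b₁)

  digits≤d⇒window : ∀ u → All (_≤ d) u →
    Above (val d u) (suc (valFrom d 2 u)) × Below (val d u + 1) (valFrom d 2 u + d)
  digits≤d⇒window [] [] = above₀ , below₀
    where
      above₀ : Above 0 1
      above₀ rewrite *-zeroʳ d = s≤s z≤n
      below₀ : Below 1 d
      below₀ = subst (d * d <_) (sym (square₁ d)) (m<m+n (d * d) (s≤s z≤n))
        where
          square₁ : ∀ d → d * 1 * d + 1 * 1 ≡ d * d + 1
          square₁ = solve-∀
  digits≤d⇒window (a ∷ u) (a≤d ∷ u≤d) rewrite valFrom-rec 1 u with digits≤d⇒window u u≤d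
  ... | above , below =
      subst₂ Above (first₁ a y) (next₁ d a x y) (below⇒above (below-antimono below (+-monoʳ-≤ y a≤d)))
    , subst₂ Below (first₂ a y) (next₂ d a x y) (above⇒below (above-mono above (m≤m+n (suc y) a)))
    where
      x = val d u
      y = valFrom d 2 u
      first₁ : ∀ a y → y + a ≡ a * 1 + y
      first₁ = solve-∀
      next₁ : ∀ d a x y → x + 1 + d * (y + a) ≡ suc (a * (d * 1 + 0) + (d * y + x))
      next₁ = solve-∀
      first₂ : ∀ a y → suc y + a ≡ a * 1 + y + 1
      first₂ = solve-∀
      next₂ : ∀ d a x y → x + d * (suc y + a) ≡ a * (d * 1 + 0) + (d * y + x) + d
      next₂ = solve-∀

  ostrowski⇒above : 0 < d → ∀ u → IsOstrowski d u → Above (val d u + 1) (suc (valFrom d 2 u + d))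
  ostrowski⇒above d>0 [] _ = subst (d * 1 * suc d + 1 * 1 <_) (sym (square d)) (m<m+n _ d>0)
    where
      square : ∀ d → suc d * suc d ≡ (d * 1 * suc d + 1 * 1) + d
      square = solve-∀
  ostrowski⇒above _ (a ∷ u) (a<d , _ ∷ u≤d , _) rewrite valFrom-rec 1 u =
    subst₂ Above (first a y) (next d a x y)
      (below⇒above (below-antimono (proj₂ (digits≤d⇒window u u≤d)) (+-monoʳ-≤ y a<d)))
    where
      x = val d u
      y = valFrom d 2 u
      first : ∀ a y → y + suc a ≡ a * 1 + y + 1
      first = solve-∀
      next : ∀ d a x y → x + 1 + d * (y + suc a) ≡ suc (a * (d * 1 + 0) + (d * y + x) + d)
      next = solve-∀

  window⇒shift : 0 < d → ∀ u y → IsOstrowski d u →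
    Below (val d u + 1) (y + d) → Above (val d u + 1) (suc (y + d)) → y ≡ valFrom d 2 u
  window⇒shift d>0 u y ost below above = +-cancelʳ-≡ d y (valFrom d 2 u)
    (floor-unique below above
      (proj₂ (digits≤d⇒window u (proj₁ (proj₂ ost)))) (ostrowski⇒above d>0 u ost))

module Representation (e : ℕ) where
  d : ℕ
  d = suc e

  open Values d

  D-step : ∀ n → D d n ≤ D d (suc n)
  D-step zero = z≤n
  D-step (suc n) = ≤-trans (m≤m+n (D d (suc n)) _) (m≤m+n _ (D d n))

  D-pos : ∀ n → 0 < D d (suc n)
  D-pos zero = s≤s z≤n
  D-pos (suc n) = ≤-trans (D-pos n) (D-step (suc n))

  D-mono : ∀ {m n} → m ≤ n → D d m ≤ D d n
  D-mono m≤n = go (≤⇒≤′ m≤n)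
    where
      go : ∀ {m n} → m ≤′ n → D d m ≤ D d n
      go ≤′-refl = ≤-refl
      go (≤′-step {n} p) = ≤-trans (go p) (D-step n)

  n<D : ∀ n → n < D d (2 + n)
  n<D zero = D-pos 1
  n<D (suc n) = begin-strict
    suc n                       ≡⟨ +-comm 1 n ⟩
    n + 1                       <⟨ +-mono-<-≤ (n<D n) (D-pos n) ⟩
    D d (2 + n) + D d (1 + n)   ≤⟨ +-monoˡ-≤ (D d (1 + n)) (m≤m+n (D d (2 + n)) _) ⟩
    D d (3 + n)                 ∎
    where open ≤-Reasoning

  AdjOkʳ : List ℕ → ℕ → Set
  AdjOkʳ [] a = ⊤
  AdjOkʳ (x ∷ []) a = a ≡ d → x ≡ 0
  AdjOkʳ (x ∷ y ∷ r) a = AdjOkʳ (y ∷ r) a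

  adjOk-∷ʳ⁻ : ∀ xs a → AdjOk d (xs ++ [ a ]) → AdjOk d xs × AdjOkʳ xs a
  adjOk-∷ʳ⁻ [] a _ = tt , tt
  adjOk-∷ʳ⁻ (x ∷ []) a (adj , _) = tt , adj
  adjOk-∷ʳ⁻ (x ∷ y ∷ r) a (adj , rest) = let rest′ , adjʳ = adjOk-∷ʳ⁻ (y ∷ r) a rest in (adj , rest′) , adjʳ

  adjOk-∷ʳ⁺ : ∀ xs a → AdjOk d xs → AdjOkʳ xs a → AdjOk d (xs ++ [ a ])
  adjOk-∷ʳ⁺ [] a _ _ = tt
  adjOk-∷ʳ⁺ (x ∷ []) a _ adjʳ = adjʳ , tt
  adjOk-∷ʳ⁺ (x ∷ y ∷ r) a (adj , rest) adjʳ = adj , adjOk-∷ʳ⁺ (y ∷ r) a rest adjʳ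

  adjOkʳ-∷ʳ⁻ : ∀ ys b a → AdjOkʳ (ys ++ [ b ]) a → a ≡ d → b ≡ 0
  adjOkʳ-∷ʳ⁻ [] b a adjʳ = adjʳ
  adjOkʳ-∷ʳ⁻ (y ∷ []) b a adjʳ = adjʳ
  adjOkʳ-∷ʳ⁻ (y ∷ z ∷ r) b a adjʳ = adjOkʳ-∷ʳ⁻ (z ∷ r) b a adjʳ

  adjOkʳ-∷ʳ⁺ : ∀ ys b a → (a ≡ d → b ≡ 0) → AdjOkʳ (ys ++ [ b ]) a
  adjOkʳ-∷ʳ⁺ [] b a h = h
  adjOkʳ-∷ʳ⁺ (y ∷ []) b a h = h
  adjOkʳ-∷ʳ⁺ (y ∷ z ∷ r) b a h = adjOkʳ-∷ʳ⁺ (z ∷ r) b a h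

  firstDigitOk-∷ʳ⁻ : ∀ xs a → FirstDigitOk d (xs ++ [ a ]) → FirstDigitOk d xs × (xs ≡ [] → a < d)
  firstDigitOk-∷ʳ⁻ [] a a<d = tt , λ _ → a<d
  firstDigitOk-∷ʳ⁻ (x ∷ xs) a x<d = x<d , λ ()

  firstDigitOk-∷ʳ⁺ : ∀ xs a → FirstDigitOk d xs → (xs ≡ [] → a < d) → FirstDigitOk d (xs ++ [ a ])
  firstDigitOk-∷ʳ⁺ [] a _ a<d = a<d refl
  firstDigitOk-∷ʳ⁺ (x ∷ xs) a x<d _ = x<d

  ostrowski-∷ʳ⁻ : ∀ xs a → IsOstrowski d (xs ++ [ a ]) →
    IsOstrowski d xs × a ≤ d × AdjOkʳ xs a × (xs ≡ [] → a < d)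
  ostrowski-∷ʳ⁻ xs a (first , digits , adj) with ++⁻ʳ xs digits
  ... | a≤d ∷ [] =
    (proj₁ (firstDigitOk-∷ʳ⁻ xs a first) , ++⁻ˡ xs digits , proj₁ (adjOk-∷ʳ⁻ xs a adj)) ,
    a≤d , proj₂ (adjOk-∷ʳ⁻ xs a adj) , proj₂ (firstDigitOk-∷ʳ⁻ xs a first)

  ostrowski-∷ʳ⁺ : ∀ xs a → IsOstrowski d xs → a ≤ d → AdjOkʳ xs a → (xs ≡ [] → a < d) →
    IsOstrowski d (xs ++ [ a ])
  ostrowski-∷ʳ⁺ xs a (first , digits , adj) a≤d adjʳ a<d =
    firstDigitOk-∷ʳ⁺ xs a first a<d , ++⁺ digits (a≤d ∷ []) , adjOk-∷ʳ⁺ xs a adj adjʳ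

  val<D : ∀ u → IsOstrowski d u → val d u < D d (suc (length u))
  val<D u = bound (reverseView u)
    where
      bound : ∀ {u} → Reverse u → IsOstrowski d u → val d u < D d (suc (length u))
      -- a final digit d is preceded by 0, so the bound for the shorter word applies
      bound-before-d : ∀ {ys b} → Reverse ys → IsOstrowski d (ys ++ [ b ]) → AdjOkʳ (ys ++ [ b ]) d →
        val d (ys ++ [ b ]) < D d (length (ys ++ [ b ]))

      bound [] _ = s≤s z≤n
      bound (xs ∶ rs ∶ʳ a) ost with ostrowski-∷ʳ⁻ xs a ost
      ... | ost-xs , a≤d , adjʳ , first rewrite val-∷ʳ xs a | length-∷ʳ xs a with m≤n⇒m<n∨m≡n a≤d
      ... | inj₁ a<d = subst (val d xs + a * Y <_) (+-comm (D d (length xs)) (d * Y))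
                         (+-*-< (D d (length xs)) (bound rs ost-xs) a<d)
        where Y = D d (suc (length xs))
      ... | inj₂ refl with rs
      ...   | [] = ⊥-elim (<-irrefl refl (first refl))
      ...   | _ ∶ rs′ ∶ʳ _ = subst (_< d * Y + D d (length xs)) (+-comm (d * Y) (val d xs))
                                   (+-monoʳ-< (d * Y) (bound-before-d rs′ ost-xs adjʳ))
        where Y = D d (suc (length xs))

      bound-before-d {ys} {b} rs ost adjʳ with adjOkʳ-∷ʳ⁻ ys b d adjʳ refl
      ... | refl = begin-strict
        val d (ys ++ [ 0 ])          ≡⟨ trans (val-∷ʳ ys 0) (+-identityʳ (val d ys)) ⟩
        val d ys                     <⟨ bound rs (proj₁ (ostrowski-∷ʳ⁻ ys 0 ost)) ⟩
        D d (suc (length ys))        ≡⟨ cong (D d) (sym (length-∷ʳ ys 0)) ⟩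
        D d (length (ys ++ [ 0 ]))   ∎
        where open ≤-Reasoning

  D≤val : ∀ u → LastNonzero u → D d (length u) ≤ val d u
  D≤val .(p ++ [ x ]) (p , x , refl , x≢0) = begin
    D d (length (p ++ [ x ]))              ≡⟨ cong (D d) (length-∷ʳ p x) ⟩
    D d (suc (length p))                   ≤⟨ m≤n*m _ x ⦃ ≢-nonZero x≢0 ⦄ ⟩
    x * D d (suc (length p))               ≤⟨ m≤n+m _ (val d p) ⟩
    val d p + x * D d (suc (length p))     ≡⟨ sym (val-∷ʳ p x) ⟩
    val d (p ++ [ x ])                     ∎
    where open ≤-Reasoning

  val-pos : ∀ u → LastNonzero u → 0 < val d u
  val-pos u@.(p ++ [ x ]) lnz@(p , x , refl , _) =
    ≤-trans (subst (λ n → 0 < D d n) (sym (length-∷ʳ p x)) (D-pos (length p))) (D≤val u lnz)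

  NoTrailingZero : List ℕ → Set
  NoTrailingZero u = u ≡ [] ⊎ LastNonzero u

  equal-length-unique : ∀ {u v} → Reverse u → Reverse v → IsOstrowski d u → IsOstrowski d v →
    length u ≡ length v → val d u ≡ val d v → u ≡ v
  equal-length-unique [] [] _ _ _ _ = refl
  equal-length-unique [] (ys ∶ _ ∶ʳ b) _ _ len _ with trans len (length-∷ʳ ys b)
  ... | ()
  equal-length-unique (xs ∶ _ ∶ʳ a) [] _ _ len _ with trans (sym (length-∷ʳ xs a)) len
  ... | ()
  equal-length-unique (xs ∶ rs ∶ʳ a) (ys ∶ rs′ ∶ʳ b) ost ost′ len values =
    cong₂ _++_ xs≡ys (cong [_] a≡b)
    where
      ost-xs : IsOstrowski d xs
      ost-xs = proj₁ (ostrowski-∷ʳ⁻ xs a ost)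
      ost-ys : IsOstrowski d ys
      ost-ys = proj₁ (ostrowski-∷ʳ⁻ ys b ost′)
      len′ : length xs ≡ length ys
      len′ = suc-injective (trans (sym (length-∷ʳ xs a)) (trans len (length-∷ʳ ys b)))
      Y = D d (suc (length xs))
      split : val d xs + a * Y ≡ val d ys + b * Y
      split = begin
        val d xs + a * Y                             ≡⟨ sym (val-∷ʳ xs a) ⟩
        val d (xs ++ [ a ])                          ≡⟨ values ⟩
        val d (ys ++ [ b ])                          ≡⟨ val-∷ʳ ys b ⟩
        val d ys + b * D d (suc (length ys))         ≡⟨ cong (λ n → val d ys + b * D d (suc n)) (sym len′) ⟩
        val d ys + b * Y                             ∎
        where open ≡-Reasoning
      ys<Y : val d ys < Y
      ys<Y = subst (λ n → val d ys < D d (suc n)) (sym len′) (val<D ys ost-ys)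
      a≡b : a ≡ b
      a≡b = digit-unique (val<D xs ost-xs) ys<Y split
      xs≡ys : xs ≡ ys
      xs≡ys = equal-length-unique rs rs′ ost-xs ost-ys len′
        (+-cancelʳ-≡ (b * Y) _ _ (subst (λ c → val d xs + c * Y ≡ val d ys + b * Y) a≡b split))

  ostrowski-unique : ∀ {u v} → IsOstrowski d u → IsOstrowski d v → NoTrailingZero u → NoTrailingZero v →
    val d u ≡ val d v → u ≡ v
  ostrowski-unique _ _ (inj₁ refl) (inj₁ refl) _ = refl
  ostrowski-unique {v = v} _ _ (inj₁ refl) (inj₂ lnz) eq = ⊥-elim (<-irrefl eq (val-pos v lnz))
  ostrowski-unique {u} _ _ (inj₂ lnz) (inj₁ refl) eq = ⊥-elim (<-irrefl (sym eq) (val-pos u lnz))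
  ostrowski-unique {u} {v} ost ost′ (inj₂ lnz) (inj₂ lnz′) eq with <-cmp (length u) (length v)
  ... | tri< lt _ _ = ⊥-elim (<-irrefl eq (<-≤-trans (val<D u ost) (≤-trans (D-mono lt) (D≤val v lnz′))))
  ... | tri≈ _ len _ = equal-length-unique (reverseView u) (reverseView v) ost ost′ len eq
  ... | tri> _ _ gt = ⊥-elim (<-irrefl (sym eq) (<-≤-trans (val<D v ost′) (≤-trans (D-mono gt) (D≤val u lnz))))

  val<D⇒adjOkʳ : ∀ u a → (a ≡ d → val d u < D d (length u)) → AdjOkʳ u a
  val<D⇒adjOkʳ u a = go (reverseView u)
    where
      go : ∀ {u} → Reverse u → (a ≡ d → val d u < D d (length u)) → AdjOkʳ u a
      go [] _ = tt
      go (ys ∶ _ ∶ʳ b) small = adjOkʳ-∷ʳ⁺ ys b a last-zero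
        where
          last-zero : a ≡ d → b ≡ 0
          last-zero a≡d with b ≟ 0
          ... | yes b≡0 = b≡0
          ... | no b≢0 = ⊥-elim (<⇒≱ (small a≡d) (D≤val (ys ++ [ b ]) (ys , b , refl , b≢0)))

  -- The last digit is the quotient by D_(k+1); when it equals d, the remainder lies below D_k,
  -- which forces a 0 before it.
  greedy : ∀ k x → x < D d (suc k) → ∃[ u ] (length u ≡ k × IsOstrowski d u × val d u ≡ x)
  greedy zero zero _ = [] , refl , (tt , [] , tt) , refl
  greedy zero (suc x) (s≤s ())
  greedy (suc k) x x<D =
    let u , len-u , ost-u , val-u = greedy k r r<Y in
    u ++ [ q ] ,
    trans (length-∷ʳ u q) (cong suc len-u) ,
    ostrowski-∷ʳ⁺ u q ost-u q≤d
      (val<D⇒adjOkʳ u q (λ q≡d → subst₂ (λ v n → v < D d n) (sym val-u) (sym len-u) (q≡d⇒r<D q≡d)))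
      (λ u≡[] → q<d-when-k≡0 (trans (sym len-u) (cong length u≡[]))) ,
    (begin
      val d (u ++ [ q ])                    ≡⟨ val-∷ʳ u q ⟩
      val d u + q * D d (suc (length u))    ≡⟨ cong₂ (λ v n → v + q * D d (suc n)) val-u len-u ⟩
      r + q * Y                             ≡⟨ sym x≡r+qY ⟩
      x                                     ∎)
    where
      open ≡-Reasoning
      Y = D d (suc k)
      instance
        Y-nonZero : NonZero Y
        Y-nonZero = >-nonZero (D-pos k)
      q = x / Y
      r = x % Y
      r<Y : r < Y
      r<Y = m%n<n x Y
      x≡r+qY : x ≡ r + q * Y
      x≡r+qY = m≡m%n+[m/n]*n x Y
      q≤d : q ≤ d
      q≤d = s≤s⁻¹ (m<n*o⇒m/o<n (<-≤-trans x<D (subst (d * Y + D d k ≤_) (+-comm (d * Y) Y)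
              (+-monoʳ-≤ (d * Y) (D-step k)))))
      q≡d⇒r<D : q ≡ d → r < D d k
      q≡d⇒r<D q≡d = +-cancelˡ-< (d * Y) r (D d k)
        (subst (_< d * Y + D d k) (trans x≡r+qY (trans (cong (λ c → r + c * Y) q≡d) (+-comm r (d * Y)))) x<D)
      q<d-when-k≡0 : k ≡ 0 → q < d
      q<d-when-k≡0 refl = m<n*o⇒m/o<n (subst (x <_) (+-identityʳ (d * 1)) x<D)

  drop-trailing-zeros : ∀ u → IsOstrowski d u → ∃[ v ] (IsOstrowski d v × NoTrailingZero v × val d v ≡ val d u)
  drop-trailing-zeros u = go (reverseView u)
    where
      go : ∀ {u} → Reverse u → IsOstrowski d u → ∃[ v ] (IsOstrowski d v × NoTrailingZero v × val d v ≡ val d u)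
      go [] ost = [] , ost , inj₁ refl , refl
      go (xs ∶ rs ∶ʳ a) ost with a ≟ 0
      ... | no a≢0 = xs ++ [ a ] , ost , inj₂ (xs , a , refl , a≢0) , refl
      ... | yes refl =
        let v , ost-v , ntz-v , val-v = go rs (proj₁ (ostrowski-∷ʳ⁻ xs 0 ost))
        in v , ost-v , ntz-v , trans val-v (sym (trans (val-∷ʳ xs 0) (+-identityʳ (val d xs))))

  representation : ∀ N → ∃[ u ] (IsOstrowski d u × NoTrailingZero u × val d u ≡ N)
  representation N =
    let u , _ , ost , val-u = greedy (suc N) N (n<D N)
        v , ost-v , ntz-v , val-v = drop-trailing-zeros u ost
    in v , ost-v , ntz-v , trans val-v val-u

  repr : ℕ → List ℕ
  repr N = proj₁ (representation N)

  repr-ostrowski : ∀ N → IsOstrowski d (repr N)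
  repr-ostrowski N = proj₁ (proj₂ (representation N))

  repr-noTrailingZero : ∀ N → NoTrailingZero (repr N)
  repr-noTrailingZero N = proj₁ (proj₂ (proj₂ (representation N)))

  repr-val : ∀ N → val d (repr N) ≡ N
  repr-val N = proj₂ (proj₂ (proj₂ (representation N)))

  repr-lastNonzero : ∀ {N} → 0 < N → LastNonzero (repr N)
  repr-lastNonzero {N} N>0 with repr-noTrailingZero N
  ... | inj₂ lnz = lnz
  ... | inj₁ repr≡[] = ⊥-elim (<-irrefl (trans (sym (cong (val d) repr≡[])) (repr-val N)) N>0)

  repr-val⁻¹ : ∀ {u} → IsOstrowski d u → NoTrailingZero u → repr (val d u) ≡ u
  repr-val⁻¹ {u} ost ntz =
    ostrowski-unique (repr-ostrowski (val d u)) ost (repr-noTrailingZero (val d u)) ntz (repr-val (val d u))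

  ZeroPrefixed : List ℕ → Set
  ZeroPrefixed u = ∃[ v ] (u ≡ 0 ∷ v × IsOstrowski d v)

  firstDigitOk? : ∀ v → Dec (FirstDigitOk d v)
  firstDigitOk? [] = yes tt
  firstDigitOk? (x ∷ _) = x <? d

  adjOk? : ∀ v → Dec (AdjOk d v)
  adjOk? [] = yes tt
  adjOk? (x ∷ []) = yes tt
  adjOk? (x ∷ y ∷ r) = ((y ≟ d) →-dec (x ≟ 0)) ×-dec adjOk? (y ∷ r)

  ostrowski? : ∀ v → Dec (IsOstrowski d v)
  ostrowski? v = firstDigitOk? v ×-dec (all? (_≤? d) v ×-dec adjOk? v)

  zeroPrefixed? : ∀ u → Dec (ZeroPrefixed u)
  zeroPrefixed? [] = no λ { (_ , () , _) }
  zeroPrefixed? (suc a ∷ v) = no λ { (_ , () , _) }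
  zeroPrefixed? (zero ∷ v) with ostrowski? v
  ... | yes ost = yes (v , refl , ost)
  ... | no ¬ost = no λ { (_ , refl , ost) → ¬ost ost }

  ostrowski-zeros : ∀ k {v} → IsOstrowski d v → IsOstrowski d (replicate k 0 ++ v)
  ostrowski-zeros zero ost = ost
  ostrowski-zeros (suc k) {v} ost with replicate k 0 ++ v | ostrowski-zeros k ost
  ... | [] | (_ , digits , _) = s≤s z≤n , z≤n ∷ digits , tt
  ... | y ∷ r | (_ , digits , adj) = s≤s z≤n , z≤n ∷ digits , (λ _ → refl) , adj

  lastNonzero-zeros : ∀ k {v} → LastNonzero v → LastNonzero (replicate k 0 ++ v)
  lastNonzero-zeros zero lnz = lnz
  lastNonzero-zeros (suc k) lnz with lastNonzero-zeros k lnz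
  ... | p , x , eq , x≢0 = 0 ∷ p , x , cong (0 ∷_) eq , x≢0

  lastNonzero-0∷⁻ : ∀ {v} → LastNonzero (0 ∷ v) → LastNonzero v
  lastNonzero-0∷⁻ ([] , x , eq , x≢0) = ⊥-elim (x≢0 (sym (proj₁ (∷-injective eq))))
  lastNonzero-0∷⁻ (_ ∷ p , x , eq , x≢0) = p , x , proj₂ (∷-injective eq) , x≢0

  decompose : ∀ u → IsOstrowski d u → LastNonzero u → ∃[ k ] ∃[ t ] (u ≡ replicate k 0 ++ t × IsTrimmed d t)
  decompose [] _ ([] , _ , () , _)
  decompose [] _ (_ ∷ _ , _ , () , _)
  decompose u@(_ ∷ v) ost lnz with zeroPrefixed? u
  ... | no ¬zp = 0 , u , refl , ost , lnz , ¬zp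
  ... | yes (_ , refl , ost-v) =
    let k , t , v≡ , trimmed = decompose v ost-v (lastNonzero-0∷⁻ lnz)
    in suc k , t , cong (0 ∷_) v≡ , trimmed

  decompose-unique : ∀ k k′ {t t′} → IsTrimmed d t → IsTrimmed d t′ →
    replicate k 0 ++ t ≡ replicate k′ 0 ++ t′ → k ≡ k′ × t ≡ t′
  decompose-unique zero zero _ _ eq = refl , eq
  decompose-unique zero (suc k′) (_ , _ , ¬zp) (ost′ , _) eq = ⊥-elim (¬zp (_ , eq , ostrowski-zeros k′ ost′))
  decompose-unique (suc k) zero (ost , _) (_ , _ , ¬zp′) eq = ⊥-elim (¬zp′ (_ , sym eq , ostrowski-zeros k ost))
  decompose-unique (suc k) (suc k′) trimmed trimmed′ eq
    with decompose-unique k k′ trimmed trimmed′ (proj₂ (∷-injective eq))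
  ... | refl , t≡t′ = refl , t≡t′

  digits<d⇒ostrowski : ∀ u → All (_< d) u → IsOstrowski d u
  digits<d⇒ostrowski u digits = first u digits , All.map <⇒≤ digits , adj u digits
    where
      first : ∀ u → All (_< d) u → FirstDigitOk d u
      first [] _ = tt
      first (_ ∷ _) (x<d ∷ _) = x<d
      adj : ∀ u → All (_< d) u → AdjOk d u
      adj [] _ = tt
      adj (x ∷ []) _ = tt
      adj (x ∷ y ∷ r) (_ ∷ y<d ∷ rest) = (λ y≡d → ⊥-elim (<-irrefl y≡d y<d)) , adj (y ∷ r) (y<d ∷ rest)

module Stolarsky (e : ℕ) where
  d : ℕ
  d = 2 + e

  open Values d
  open Golden d
  open Representation (suc e) hiding (d)

  HasTrimmedRepr : ℕ → Set
  HasTrimmedRepr N = 0 < N × ¬ ZeroPrefixed (repr N)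

  hasTrimmedRepr? : ∀ N → Dec (HasTrimmedRepr N)
  hasTrimmedRepr? N = (0 <? N) ×-dec ¬? (zeroPrefixed? (repr N))

  trimmed-repr : ∀ {N} → HasTrimmedRepr N → IsTrimmed d (repr N)
  trimmed-repr {N} (N>0 , ¬zp) = repr-ostrowski N , repr-lastNonzero N>0 , ¬zp

  trimmed-unbounded : ∀ x → ∃[ y ] (x < y × HasTrimmedRepr y)
  trimmed-unbounded x =
    val d u , x<val , val-pos u lnz , subst (λ v → ¬ ZeroPrefixed v) (sym repr≡u) λ { (_ , () , _) }
    where
      u : List ℕ
      u = 1 ∷ replicate x 0 ++ [ 1 ]
      1<d : 1 < d
      1<d = s≤s (s≤s z≤n)
      lnz : LastNonzero u
      lnz = 1 ∷ replicate x 0 , 1 , refl , λ ()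
      repr≡u : repr (val d u) ≡ u
      repr≡u = repr-val⁻¹ (digits<d⇒ostrowski u (1<d ∷ ++⁺ (all-zeros x) (1<d ∷ []))) (inj₂ lnz)
        where
          all-zeros : ∀ k → All (_< d) (replicate k 0)
          all-zeros zero = []
          all-zeros (suc k) = s≤s z≤n ∷ all-zeros k
      x<val : x < val d u
      x<val = begin-strict
        x                         <⟨ n<D x ⟩
        D d (2 + x)               ≤⟨ m≤n+m _ 1 ⟩
        1 + D d (2 + x)           ≡⟨ cong (1 +_) (sym (trans (+-identityʳ _) (*-identityˡ _))) ⟩
        1 + (1 * D d (2 + x) + 0) ≡⟨ cong (1 +_) (sym (valFrom-zeros 2 x [ 1 ])) ⟩
        val d u                   ∎
        where open ≤-Reasoning

  open Enumeration HasTrimmedRepr hasTrimmedRepr? trimmed-unbounded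

  listing : ℕ → List ℕ
  listing m = repr (enum m)

  listing-isTrimmedListing : IsTrimmedListing d listing
  listing-isTrimmedListing = trimmed , increasing , surjective
    where
      trimmed : ∀ m → 1 ≤ m → IsTrimmed d (listing m)
      trimmed (suc m) _ = trimmed-repr (enum-P m)
      increasing : ∀ m m′ → 1 ≤ m → m < m′ → val d (listing m) < val d (listing m′)
      increasing m m′ _ m<m′ = subst₂ _<_ (sym (repr-val (enum m))) (sym (repr-val (enum m′))) (enum-mono m<m′)
      surjective : ∀ u → IsTrimmed d u → ∃[ m ] (1 ≤ m × listing m ≡ u)
      surjective u (ost , lnz , ¬zp) =
        let m , m≥1 , enum-m≡ = enum-surjective (val d u) (val-pos u lnz)
                                  (val-pos u lnz , subst (λ v → ¬ ZeroPrefixed v) (sym repr≡u) ¬zp)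
        in m , m≥1 , trans (cong repr enum-m≡) repr≡u
        where
          repr≡u : repr (val d u) ≡ u
          repr≡u = repr-val⁻¹ ost (inj₂ lnz)

  cassini : ℕ → ℕ → ℕ
  cassini x y = ∣ y * y - d * x * y + x * x ∣

  cassini-step : ∀ x y → cassini y (d * y + x) ≡ cassini x y
  cassini-step x y = begin
    ∣ L′ - R′ ∣              ≡⟨ sym (∣m+n-m+o∣≡∣n-o∣ L L′ R′) ⟩
    ∣ L + L′ - L + R′ ∣      ≡⟨ cong₂ ∣_-_∣ (swap d x y) (+-comm L R′) ⟩
    ∣ R′ + R - R′ + L ∣      ≡⟨ ∣m+n-m+o∣≡∣n-o∣ R′ R L ⟩
    ∣ R - L ∣                ≡⟨ ∣-∣-comm R L ⟩
    ∣ L - R ∣                ∎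
    where
      open ≡-Reasoning
      L = y * y
      R = d * x * y + x * x
      L′ = (d * y + x) * (d * y + x)
      R′ = d * y * (d * y + x) + y * y
      swap : ∀ d x y → y * y + (d * y + x) * (d * y + x) ≡ (d * y * (d * y + x) + y * y) + (d * x * y + x * x)
      swap = solve-∀

  -- φ (x + 1) − d − y = (φ x − y) + 1/φ with 1/φ ∈ (0, 1), and Cassini's bound makes φ x − y small.
  cassini⇒below : ∀ {w z x y} → x ≡ d * z + w → y ≡ d * x + z → cassini x y ≤ z → Below (x + 1) (y + d)
  cassini⇒below {w} {z} refl refl c≤z = begin
    suc ((y + d) * (y + d))                             ≡⟨ expand e x y ⟩
    y * y + K                                           ≤⟨ +-monoˡ-≤ K (m≤n+∣m-n∣ (y * y) (d * x * y + x * x)) ⟩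
    d * x * y + x * x + cassini x y + K                 ≤⟨ +-monoˡ-≤ K (+-monoʳ-≤ (d * x * y + x * x) c≤z) ⟩
    d * x * y + x * x + z + K                           ≤⟨ m≤m+n _ _ ⟩
    d * x * y + x * x + z + K + ((1 + e) * z + 2 * w)   ≡⟨ sym (regroup e z w) ⟩
    d * (x + 1) * (y + d) + (x + 1) * (x + 1)           ∎
    where
      open ≤-Reasoning
      x = d * z + w
      y = d * x + z
      K = 2 * d * y + d * d + 1
      expand : ∀ e x y → let d = 2 + e in suc ((y + d) * (y + d)) ≡ y * y + (2 * d * y + d * d + 1)
      expand = solve-∀
      regroup : ∀ e z w → let d = 2 + e ; x = d * z + w ; y = d * x + z in
        d * (x + 1) * (y + d) + (x + 1) * (x + 1)
          ≡ (d * x * y + x * x + z) + (2 * d * y + d * d + 1) + ((1 + e) * z + 2 * w)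
      regroup = solve-∀

  cassini⇒above : ∀ {z x y} → y ≡ d * x + z → cassini x y ≤ z → Above (x + 1) (suc (y + d))
  cassini⇒above {z} {x} refl c≤z = begin
    suc (d * (x + 1) * suc (y + d) + (x + 1) * (x + 1))  ≡⟨ expand e x y ⟩
    d * x * y + x * x + K′                               ≤⟨ +-monoˡ-≤ K′ (m≤n+∣n-m∣ (d * x * y + x * x) (y * y)) ⟩
    y * y + cassini x y + K′                             ≤⟨ +-monoˡ-≤ K′ (+-monoʳ-≤ (y * y) c≤z) ⟩
    y * y + z + K′                                       ≤⟨ m≤m+n _ _ ⟩
    y * y + z + K′ + (d * z + e * x + z + 1 + e)         ≡⟨ sym (regroup e z x) ⟩
    suc (y + d) * suc (y + d)                            ∎
    where
      open ≤-Reasoning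
      y = d * x + z
      K′ = d * d * x + d * x + d * y + d * d + d + 2 * x + 2
      expand : ∀ e x y → let d = 2 + e in
        suc (d * (x + 1) * suc (y + d) + (x + 1) * (x + 1))
          ≡ (d * x * y + x * x) + (d * d * x + d * x + d * y + d * d + d + 2 * x + 2)
      expand = solve-∀
      regroup : ∀ e z x → let d = 2 + e ; y = d * x + z in
        suc (y + d) * suc (y + d)
          ≡ (y * y + z) + (d * d * x + d * x + d * y + d * d + d + 2 * x + 2) + (d * z + e * x + z + 1 + e)
      regroup = solve-∀

  module _ (B : ℕ → ℕ) (B-pos : ∀ n → 1 ≤ n → 1 ≤ B n) (B-rec : ∀ n → 2 ≤ n → B (suc n) ≡ d * B n + B (n ∸ 1))
    where
    private
      rec : ∀ k → B (3 + k) ≡ d * B (2 + k) + B (1 + k)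
      rec k = B-rec (2 + k) (s≤s (s≤s z≤n))

    cassini-const : ∀ k → cassini (B (2 + k)) (B (3 + k)) ≡ cassini (B 2) (B 3)
    cassini-const zero = refl
    cassini-const (suc k) =
      trans (cong (cassini (B (3 + k))) (rec (suc k))) (trans (cassini-step (B (2 + k)) (B (3 + k))) (cassini-const k))

    index≤term : ∀ k → k ≤ B (2 + k)
    index≤term zero = z≤n
    index≤term (suc k) = begin
      suc k                         ≡⟨ +-comm 1 k ⟩
      k + 1                         ≤⟨ +-mono-≤ (index≤term k) (B-pos (1 + k) (s≤s z≤n)) ⟩
      B (2 + k) + B (1 + k)         ≤⟨ +-monoˡ-≤ (B (1 + k)) (m≤n*m (B (2 + k)) d) ⟩
      d * B (2 + k) + B (1 + k)     ≡⟨ sym (rec k) ⟩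
      B (3 + k)                     ∎
      where open ≤-Reasoning

    recurrent⇒eventually-row :
      ∃[ n₀ ] ∃[ u ] (IsOstrowski d u × LastNonzero u × (∀ i → B (i + n₀) ≡ valFrom d (suc i) u))
    recurrent⇒eventually-row =
      n₀ , u , repr-ostrowski x , repr-lastNonzero (B-pos n₀ (s≤s z≤n)) ,
      recurrence-unique (λ i → B-rec (suc (i + n₀)) (s≤s (≤-trans (s≤s z≤n) (m≤n+m n₀ i))))
                        (λ i → valFrom-rec (suc i) u) (sym (repr-val x)) y≡
      where
        c = cassini (B 2) (B 3)
        -- from index 3 + c on, the term two steps back is at least c
        n₀ = 3 + c
        x = B n₀
        y = B (1 + n₀)
        u = repr x
        c≤z : cassini x y ≤ B (2 + c)
        c≤z = subst (_≤ B (2 + c)) (sym (cassini-const (1 + c))) (index≤term c)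
        y≡ : y ≡ valFrom d 2 u
        y≡ = window⇒shift (s≤s z≤n) u y (repr-ostrowski x)
               (subst (λ t → Below (t + 1) (y + d)) (sym (repr-val x)) (cassini⇒below (rec c) (rec (1 + c)) c≤z))
               (subst (λ t → Above (t + 1) (suc (y + d))) (sym (repr-val x)) (cassini⇒above {x = x} (rec (1 + c)) c≤z))

  module _ {w : ℕ → List ℕ} (isListing : IsTrimmedListing d w) where
    private
      A = OstrowskiArray d w
      trimmed = proj₁ isListing
      surjective = proj₂ (proj₂ isListing)

    array-covers : ∀ N → 1 ≤ N → ∃[ m ] ∃[ n ] (1 ≤ m × 1 ≤ n × A m n ≡ N)
    array-covers N N≥1 =
      let k , t , repr≡ , trimmed-t = decompose (repr N) (repr-ostrowski N) (repr-lastNonzero N≥1)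
          m , m≥1 , wm≡t = surjective t trimmed-t
      in m , suc k , m≥1 , s≤s z≤n ,
         trans (cong (λ v → val d (replicate k 0 ++ v)) wm≡t) (trans (cong (val d) (sym repr≡)) (repr-val N))

    array-injective : ∀ m n m′ n′ → 1 ≤ m → 1 ≤ n → 1 ≤ m′ → 1 ≤ n′ → A m n ≡ A m′ n′ → m ≡ m′ × n ≡ n′
    array-injective m (suc a) m′ (suc a′) m≥1 _ m′≥1 _ eq
      with ostrowski-unique (ostrowski-zeros a (proj₁ (trimmed m m≥1))) (ostrowski-zeros a′ (proj₁ (trimmed m′ m′≥1)))
             (inj₂ (lastNonzero-zeros a (proj₁ (proj₂ (trimmed m m≥1)))))
             (inj₂ (lastNonzero-zeros a′ (proj₁ (proj₂ (trimmed m′ m′≥1))))) eq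
    ... | words≡ with decompose-unique a a′ (trimmed m m≥1) (trimmed m′ m′≥1) words≡
    ... | refl , wm≡wm′ = listing-injective isListing m≥1 m′≥1 wm≡wm′ , refl

    array-tailEquiv : ∀ (B : ℕ → ℕ) → (∀ n → 1 ≤ n → 1 ≤ B n) →
      (∀ n → 2 ≤ n → B (suc n) ≡ d * B n + B (n ∸ 1)) → ∃[ m ] (1 ≤ m × TailEquiv (A m) B)
    array-tailEquiv B B-pos B-rec =
      let n₀ , u , ost , lnz , row = recurrent⇒eventually-row B B-pos B-rec
          k , t , u≡ , trimmed-t = decompose u ost lnz
          m , m≥1 , wm≡t = surjective t trimmed-t
      in m , m≥1 , shifted⇒tailEquiv (suc k) n₀ λ i → begin
           A m (i + suc k)                        ≡⟨ cong (A m) (+-suc i k) ⟩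
           A m (suc (i + k))                      ≡⟨ ostrowskiArray-row w m (i + k) ⟩
           valFrom d (suc i + k) (w m)            ≡⟨ cong (valFrom d (suc i + k)) wm≡t ⟩
           valFrom d (suc i + k) t                ≡⟨ sym (valFrom-zeros (suc i) k t) ⟩
           valFrom d (suc i) (replicate k 0 ++ t) ≡⟨ cong (valFrom d (suc i)) (sym u≡) ⟩
           valFrom d (suc i) u                    ≡⟨ sym (row i) ⟩
           B (i + n₀)                             ∎
      where open ≡-Reasoning

    ostrowskiArray-isStolarsky : IsStolarsky d A
    ostrowskiArray-isStolarsky =
      (λ m n _ → ostrowskiArray-rec w m n) ,
      (λ N N≥1 → array-covers N N≥1 ,
         λ m n m′ n′ m≥1 n≥1 m′≥1 n′≥1 eq eq′ → array-injective m n m′ n′ m≥1 n≥1 m′≥1 n′≥1 (trans eq (sym eq′))) ,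
      array-tailEquiv

theorem1 : (d : ℕ) → 2 ≤ d →
    Σ (ℕ → List ℕ) (IsTrimmedListing d)
    × ((w : ℕ → List ℕ) → IsTrimmedListing d w → IsStolarsky d (OstrowskiArray d w))
theorem1 (suc (suc e)) (s≤s (s≤s z≤n)) = (listing , listing-isTrimmedListing) , λ _ → ostrowskiArray-isStolarsky
  where open Stolarsky e
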